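{- For all integers $k\ge 5$ and $\ell\ge 33$, the graph $G(k,\ell)$ does not admit a mixed layout (i.e., a mixed $1$-stack $1$-queue layout).
   Context: For $\ell\ge 1$, $G(1,\ell)$ is a single edge; for $k>1$, $G(k,\ell)$ is obtained from $G(k-1,\ell)$ by attaching $\ell$ new vertices to each edge of $G(k-1,\ell)$, where attaching a new vertex $u$ to an edge $(v,w)$ means adding $u$ and the edges $(u,v),(u,w)$. (Each $G(k,\ell)$ is a 2-tree.) A linear order of a graph is a total order $\prec$ of its vertex set. Two independent edges $(u_1,v_1),(u_2,v_2)$ with $u_i\prec v_i$ cross if $u_1\prec u_2\prec v_1\prec v_2$ and nest if $u_1\prec u_2\prec v_2\prec v_1$. A stack is a set of pairwise non-crossing edges; a queue is a set of pairwise non-nested edges. A mixed layout of a graph consists of a linear order of its vertices together with a partition of its edges into one stack and one queue. -}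

module Defs where

open import Data.Nat using (ℕ; zero; suc; _+_; _*_; _<_)
open import Data.Product using (_×_; _,_; proj₁; proj₂; Σ)
open import Data.List using (List; []; _∷_; _++_; length; lookup)
open import Data.Fin using (Fin)
open import Data.Bool using (Bool; true; false)
open import Data.Sum using (_⊎_)
open import Relation.Binary.PropositionalEquality using (_≡_)
open import Relation.Nullary using (¬_)

-- A finite graph: vertices are the naturals 0 … nV-1, edges an explicit list
-- of (unordered) pairs of vertices.
record Graph : Set where
  constructor mkGraph
  field
    nV    : ℕ
    edges : List (ℕ × ℕ)
open Graph public

attachEdge : ℕ → ℕ → ℕ → ℕ → List (ℕ × ℕ)
attachEdge zero    c v w = []
attachEdge (suc ℓ) c v w = (c , v) ∷ (c , w) ∷ attachEdge ℓ (suc c) v w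

attachAll : ℕ → ℕ → List (ℕ × ℕ) → List (ℕ × ℕ)
attachAll ℓ c []             = []
attachAll ℓ c ((v , w) ∷ es) = attachEdge ℓ c v w ++ attachAll ℓ (c + ℓ) es

step : ℕ → Graph → Graph
step ℓ (mkGraph n es) = mkGraph (n + ℓ * length es) (es ++ attachAll ℓ n es)

-- G k ℓ for k ≥ 1: G 1 ℓ is a single edge; G (k+1) ℓ = step ℓ (G k ℓ).
-- (G 0 ℓ is set to the single edge as well; it is never used.)
G : ℕ → ℕ → Graph
G zero          ℓ = mkGraph 2 ((0 , 1) ∷ [])
G (suc zero)    ℓ = mkGraph 2 ((0 , 1) ∷ [])
G (suc (suc k)) ℓ = step ℓ (G (suc k) ℓ)

-- A linear order of the vertex set 0 … n-1 is given by an injective position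
-- map pos (u ≺ v  iff  pos u < pos v).
LinearOrder : ℕ → Set
LinearOrder n = Σ (ℕ → ℕ) λ pos →
  ∀ u v → u < n → v < n → pos u ≡ pos v → u ≡ v

Oriented : (ℕ → ℕ) → ℕ × ℕ → ℕ → ℕ → Set
Oriented pos (a , b) x y = ((x ≡ a × y ≡ b) ⊎ (x ≡ b × y ≡ a)) × (pos x < pos y)

-- e = (u₁,v₁), f = (u₂,v₂) with uᵢ ≺ vᵢ cross: u₁ ≺ u₂ ≺ v₁ ≺ v₂.
-- (Strictness of ≺ forces four distinct endpoints, i.e. independent edges.)
Cross : (ℕ → ℕ) → ℕ × ℕ → ℕ × ℕ → Set
Cross pos e f = Σ ℕ λ u₁ → Σ ℕ λ v₁ → Σ ℕ λ u₂ → Σ ℕ λ v₂ →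
  Oriented pos e u₁ v₁ × Oriented pos f u₂ v₂ ×
  pos u₁ < pos u₂ × pos u₂ < pos v₁ × pos v₁ < pos v₂

Nest : (ℕ → ℕ) → ℕ × ℕ → ℕ × ℕ → Set
Nest pos e f = Σ ℕ λ u₁ → Σ ℕ λ v₁ → Σ ℕ λ u₂ → Σ ℕ λ v₂ →
  Oriented pos e u₁ v₁ × Oriented pos f u₂ v₂ ×
  pos u₁ < pos u₂ × pos u₂ < pos v₂ × pos v₂ < pos v₁

-- A mixed (1-stack 1-queue) layout: a linear order and a partition of the
-- edges (each edge of the list gets a side: true = stack, false = queue) such
-- that no two stack edges cross and no two queue edges nest.
MixedLayout : Graph → Set
MixedLayout g = Σ (LinearOrder (nV g)) λ (pos , _) →
  Σ (Fin (length (edges g)) → Bool) λ side →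
    (∀ i j → side i ≡ true → side j ≡ true →
       ¬ Cross pos (lookup (edges g) i) (lookup (edges g) j)) ×
    (∀ i j → side i ≡ false → side j ≡ false →
       ¬ Nest pos (lookup (edges g) i) (lookup (edges g) j))

module Submission where

-- Suppose G(k,ℓ) has a mixed layout and let v ≺ w span an edge carrying at least four levels of
-- attachments.  Classify each of the ℓ vertices attached to vw by its position (left of v, between
-- v and w, right of w) and by the colours of its two edges to v and w.  Of two crossing edges one
-- is a queue, of two nested edges one is a stack; iterating this bounds every class.  Two children
-- in the same position whose four edges have one colour cross or nest, except for queue pairs
-- between v and w, which are bounded by 4.  For a class of mixed colours one descends one to three
-- levels to an edge whose own ℓ children would all be forced into such classes of size one, which
-- is impossible.  Altogether at most 21 < ℓ children fit.

open import Defs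
open import Data.Nat using (ℕ; zero; suc; _+_; _*_; _≤_; _<_; _≤′_; _≤ᵇ_; z≤n; s≤s; z<s; s<s; ≤′-refl; ≤′-step)
open import Data.Nat.Properties
  using ( +-suc; +-assoc; +-identityʳ; *-suc; *-zeroʳ; +-monoʳ-≤; +-cancelˡ-≡; m≤m+n; m<m+n; m≤m*n
        ; ≤-refl; ≤-trans; <-≤-trans; <⇒≤; <-trans; <-irrefl; <-cmp; ≤ᵇ⇒≤; ≤⇒≤′ )
open import Data.Bool using (Bool; true; false; T)
open import Data.Fin using (Fin; toℕ; fromℕ<)
open import Data.Fin.Properties using (toℕ<n; toℕ-injective)
open import Data.Product using (Σ; _×_; _,_; proj₁; proj₂)
import Data.Product as Product
open import Data.Sum using (_⊎_; inj₁; inj₂)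
import Data.Sum as Sum
open import Data.List using (List; []; _∷_; length; lookup; allFin)
open import Data.List.Properties using (length-tabulate)
open import Data.List.Relation.Unary.All using (All; []; _∷_)
import Data.List.Relation.Unary.All as All
open import Data.List.Relation.Unary.All.Properties using (++⁺)
open import Data.List.Relation.Unary.AllPairs using ([]; _∷_)
open import Data.List.Relation.Unary.Any using (here; there; index)
open import Data.List.Relation.Unary.Any.Properties using (lookup-index)
open import Data.List.Relation.Unary.Unique.Propositional using (Unique)
open import Data.List.Relation.Unary.Unique.Propositional.Properties using (allFin⁺)
open import Data.List.Membership.Propositional using (_∈_)
open import Data.List.Membership.Propositional.Properties using (∈-++⁺ˡ; ∈-++⁺ʳ; ∈-++⁻)
open import Data.Empty using (⊥; ⊥-elim)
open import Function using (id; _∘_)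
open import Level using (0ℓ)
open import Relation.Unary using (Pred; _∩_; _∪_; _⊆_)
open import Relation.Nullary using (¬_)
open import Relation.Binary using (tri<; tri≈; tri>)
open import Relation.Binary.PropositionalEquality using (_≡_; _≢_; refl; sym; trans; cong; subst)

module Counting {A : Set} where

  Many : Pred A 0ℓ → ℕ → Set
  Many P n = Σ (List A) λ xs → Unique xs × All P xs × n ≤ length xs

  many-map : ∀ {P Q n} → P ⊆ Q → Many P n → Many Q n
  many-map f (xs , u , ps , len) = xs , u , All.map f ps , len

  single : ∀ {P x} → P x → Many P 1
  single {x = x} px = x ∷ [] , [] ∷ [] , px ∷ [] , s≤s z≤n

  cons : ∀ {P x n} → P x → Many (P ∩ (x ≢_)) n → Many P (suc n)
  cons {x = x} px (xs , u , ps , len) =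
    x ∷ xs , All.map proj₂ ps ∷ u , px ∷ All.map proj₁ ps , s≤s len

  uncons : ∀ {P n} → Many P (suc n) → Σ A λ x → P x × Many (P ∩ (x ≢_)) n
  uncons (x ∷ xs , x∉xs ∷ u , px ∷ ps , s≤s len) = x , px , xs , u , All.zip (ps , x∉xs) , len

  pick : ∀ {P n} → Many P (suc n) → Σ A P
  pick m = let x , px , _ = uncons m in x , px

  distribute : ∀ {P Q R : Pred A 0ℓ} → (P ∪ Q) ∩ R ⊆ (P ∩ R) ∪ (Q ∩ R)
  distribute (inj₁ p , r) = inj₁ (p , r)
  distribute (inj₂ q , r) = inj₂ (q , r)

  split : ∀ {P Q} a b → Many (P ∪ Q) (suc (a + b)) → Many P (suc a) ⊎ Many Q (suc b)
  split a b m with uncons m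
  split zero    b       m | _ , inj₁ px , _    = inj₁ (single px)
  split {P} {Q} (suc a) b m | x , inj₁ px , rest =
    Sum.map (cons px) (many-map proj₁)
      (split {P ∩ (x ≢_)} {Q ∩ (x ≢_)} a b (many-map (distribute {P} {Q} {x ≢_}) rest))
  split a       zero    m | _ , inj₂ qx , _    = inj₂ (single qx)
  split {P} {Q} a (suc b) m | x , inj₂ qx , rest =
    Sum.map (many-map proj₁) (cons qx)
      (split {P ∩ (x ≢_)} {Q ∩ (x ≢_)} a b
        (subst (Many _) (+-suc a b) (many-map (distribute {P} {Q} {x ≢_}) rest)))

  infixr 4 _∣_
  _∣_ : ∀ {P Q a b} → ¬ Many P (suc a) → ¬ Many Q (suc b) → ¬ Many (P ∪ Q) (suc (a + b))
  (f ∣ g) m = Sum.[ f , g ] (split _ _ m)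

  none : ∀ {P} → (∀ {x} → ¬ P x) → ¬ Many P 1
  none ¬p m = ¬p (proj₂ (pick m))

module Ascending {A : Set} (_<_ : A → A → Set)
  (<-trans : ∀ {x y z} → x < y → y < z → x < z) (<-irrefl : ∀ {x} → ¬ x < x)
  (compare : ∀ {x y} → x ≢ y → x < y ⊎ y < x) where

  open Counting {A}

  <⇒≢ : ∀ {x y} → x < y → x ≢ y
  <⇒≢ x<y refl = <-irrefl x<y

  least : ∀ {P n} → Many P (suc n) → Σ A λ x → P x × Many (P ∩ (x <_)) n
  least {n = zero} m with uncons m
  ... | x , px , _ = x , px , [] , [] , [] , z≤n
  least {n = suc n} m with uncons m
  ... | x , px , rest with least rest
  ...   | z , (pz , x≢z) , above with compare x≢z
  ...     | inj₁ x<z = x , px , cons (pz , x<z)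
                         (many-map (λ ((pw , _) , z<w) → (pw , <-trans x<z z<w) , <⇒≢ z<w) above)
  ...     | inj₂ z<x = z , pz , cons (px , z<x)
                         (many-map (λ ((pw , x≢w) , z<w) → (pw , z<w) , x≢w) above)

  ascending₂ : ∀ {P} → Many P 2 → Σ A λ x → Σ A λ y → P x × P y × x < y
  ascending₂ m =
    let x , px , m₁ = least m
        y , (py , x<y) = pick m₁
    in x , y , px , py , x<y

  ascending₃ : ∀ {P} → Many P 3 → Σ A λ x → Σ A λ y → Σ A λ z → (P x × P y × P z) × x < y × y < z
  ascending₃ m =
    let x , px , m₁ = least m
        y , (py , x<y) , m₂ = least m₁
        z , (pz , _) , y<z = pick m₂
    in x , y , z , (px , py , pz) , x<y , y<z

  ascending₅ : ∀ {P} → Many P 5 → Σ A λ x₁ → Σ A λ x₂ → Σ A λ x₃ → Σ A λ x₄ → Σ A λ x₅ →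
               (P x₁ × P x₅) × x₁ < x₂ × x₂ < x₃ × x₃ < x₄ × x₄ < x₅
  ascending₅ m =
    let x₁ , p₁ , m₁ = least m
        x₂ , (_ , x₁<x₂) , m₂ = least m₁
        x₃ , x₄ , x₅ , ((_ , x₂<x₃) , _ , ((p₅ , _) , _)) , x₃<x₄ , x₄<x₅ = ascending₃ m₂
    in x₁ , x₂ , x₃ , x₄ , x₅ , (p₁ , p₅) , x₁<x₂ , x₂<x₃ , x₃<x₄ , x₄<x₅

module Setting (L : ℕ) (33≤L : 33 ≤ L) (M : ℕ) (N : ℕ → ℕ) (N-mono : ∀ j → N j ≤ N (suc j))
  (E : ℕ → ℕ → Set) (E-sym : ∀ {a b} → E a b → E b a) (side : ∀ {a b} → E a b → Bool)
  (side-sym : ∀ {a b} (e : E a b) → side (E-sym e) ≡ side e) where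

  open Counting {Fin L}

  -- The hidden argument reduces to ⊤ exactly when n ≤ 33, so it is discharged by evaluation.
  refute-all : ∀ {P n} → ¬ Many P n → {T (n ≤ᵇ 33)} → ¬ (∀ i → P i)
  refute-all {n = n} ¬many {n≤33} all = ¬many
    (allFin L , allFin⁺ L , All.tabulate (λ {i} _ → all i) ,
     ≤-trans (≤ᵇ⇒≤ n 33 n≤33) (subst (33 ≤_) (sym (length-tabulate (λ i → i))) 33≤L))

  Stack Queue : ∀ {a b} → E a b → Set
  Stack e = side e ≡ true
  Queue e = side e ≡ false

  stack-or-queue : ∀ {a b} (e : E a b) → Stack e ⊎ Queue e
  stack-or-queue e with side e
  ... | true  = inj₁ refl
  ... | false = inj₂ refl

  stack-sym : ∀ {a b} {e : E a b} → Stack e → Stack (E-sym e)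
  stack-sym {e = e} = trans (side-sym e)
  queue-sym : ∀ {a b} {e : E a b} → Queue e → Queue (E-sym e)
  queue-sym {e = e} = trans (side-sym e)
  stack-unsym : ∀ {a b} {e : E a b} → Stack (E-sym e) → Stack e
  stack-unsym {e = e} = trans (sym (side-sym e))
  queue-unsym : ∀ {a b} {e : E a b} → Queue (E-sym e) → Queue e
  queue-unsym {e = e} = trans (sym (side-sym e))

  -- a is a vertex of G(j,ℓ) (label below N j) and of the whole graph (label below M).
  Old : ℕ → ℕ → Set
  Old j a = a < N j × a < M

  old-suc : ∀ {j a} → Old j a → Old (suc j) a
  old-suc {j} (a<N , a<M) = <-≤-trans a<N (N-mono j) , a<M

  Edge : ℕ → ℕ → ℕ → Set
  Edge j a b = E a b × Old j a × Old j b × a ≢ b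

  -- The edge ab of G(j,ℓ) with n rounds of attachments above it: the L vertices kid i attached to
  -- ab, whose labels are at least N j and hence new, and recursively the trees above a–kid i and
  -- b–kid i.
  mutual
    Tree : ℕ → ℕ → ℕ → ℕ → Set
    Tree zero    j a b = Edge j a b
    Tree (suc n) j a b = Node n j a b

    record Node (n j a b : ℕ) : Set where
      inductive
      eta-equality
      field
        base          : Edge j a b
        kid           : Fin L → ℕ
        kid-fresh     : ∀ i → N j ≤ kid i
        kid-injective : ∀ i i′ → kid i ≡ kid i′ → i ≡ i′
        tree₁         : ∀ i → Tree n (suc j) a (kid i)
        tree₂         : ∀ i → Tree n (suc j) b (kid i)

  open Node public

  edge-of : ∀ {n j a b} → Tree n j a b → Edge j a b
  edge-of {zero}  t = t
  edge-of {suc n} t = base t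

  module _ {n j a b} (t : Tree n j a b) where
    edge : E a b
    edge = proj₁ (edge-of t)
    old₁ : Old j a
    old₁ = proj₁ (proj₂ (edge-of t))
    old₂ : Old j b
    old₂ = proj₁ (proj₂ (proj₂ (edge-of t)))
    ends-distinct : a ≢ b
    ends-distinct = proj₂ (proj₂ (proj₂ (edge-of t)))

  tree-sym : ∀ {n j a b} → Tree n j a b → Tree n j b a
  tree-sym {zero}  (e , oa , ob , a≢b) = E-sym e , ob , oa , λ b≡a → a≢b (sym b≡a)
  tree-sym {suc n} t = record
    { base = tree-sym {zero} (base t) ; kid = kid t ; kid-fresh = kid-fresh t
    ; kid-injective = kid-injective t ; tree₁ = tree₂ t ; tree₂ = tree₁ t }

  module _ {n j p q} (g : Node n j p q) where
    edge₁ : ∀ i → E p (kid g i)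
    edge₁ i = edge (tree₁ g i)
    edge₂ : ∀ i → E q (kid g i)
    edge₂ i = edge (tree₂ g i)
    kid-old : ∀ i → Old (suc j) (kid g i)
    kid-old i = old₂ (tree₁ g i)
    -- The letters are the colours of the edges from kid i to p and to q, in this order.
    SS QQ QS SQ : Fin L → Set
    SS i = Stack (edge₁ i) × Stack (edge₂ i)
    QQ i = Queue (edge₁ i) × Queue (edge₂ i)
    QS i = Queue (edge₁ i) × Stack (edge₂ i)
    SQ i = Stack (edge₁ i) × Queue (edge₂ i)

  colours : ∀ {n j p q} (g : Node n j p q) i → SS g i ⊎ QQ g i ⊎ QS g i ⊎ SQ g i
  colours g i with stack-or-queue (edge₁ g i) | stack-or-queue (edge₂ g i)
  ... | inj₁ s₁ | inj₁ s₂ = inj₁ (s₁ , s₂)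
  ... | inj₂ q₁ | inj₂ q₂ = inj₂ (inj₁ (q₁ , q₂))
  ... | inj₂ q₁ | inj₁ s₂ = inj₂ (inj₂ (inj₁ (q₁ , s₂)))
  ... | inj₁ s₁ | inj₂ q₂ = inj₂ (inj₂ (inj₂ (s₁ , q₂)))

  record Layout : Set₁ where
    infix 4 _≺_
    field
      _≺_         : ℕ → ℕ → Set
      ≺-trans     : ∀ {a b c} → a ≺ b → b ≺ c → a ≺ c
      ≺-irrefl    : ∀ {a} → ¬ a ≺ a
      ≺-total     : ∀ {a b} → a < M → b < M → a ≢ b → a ≺ b ⊎ b ≺ a
      no-crossing : ∀ {a b c d} (e : E a b) (f : E c d) → Stack e → Stack f →
                    a ≺ c → c ≺ b → b ≺ d → ⊥
      no-nesting  : ∀ {a b c d} (e : E a b) (f : E c d) → Queue e → Queue f →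
                    a ≺ c → c ≺ d → d ≺ b → ⊥

  -- Reversing the order gives again a layout; this is how every lemma is also used with left and
  -- right exchanged.
  mirror : Layout → Layout
  mirror O = record
    { _≺_         = λ a b → b ≺ a
    ; ≺-trans     = λ a≻b b≻c → ≺-trans b≻c a≻b
    ; ≺-irrefl    = ≺-irrefl
    ; ≺-total     = λ a<M b<M a≢b → Sum.swap (≺-total a<M b<M a≢b)
    ; no-crossing = λ e f se sf p q r → no-crossing (E-sym f) (E-sym e) (stack-sym sf) (stack-sym se) r q p
    ; no-nesting  = λ e f qe qf p q r → no-nesting (E-sym e) (E-sym f) (queue-sym qe) (queue-sym qf) r q p
    }
    where open Layout O

  module Basic (O : Layout) where
    open Layout O

    crossing-queue₁ : ∀ {a b c d} (e : E a b) (f : E c d) → Stack f → a ≺ c → c ≺ b → b ≺ d → Queue e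
    crossing-queue₁ e f sf a≺c c≺b b≺d with stack-or-queue e
    ... | inj₁ se = ⊥-elim (no-crossing e f se sf a≺c c≺b b≺d)
    ... | inj₂ qe = qe

    crossing-queue₂ : ∀ {a b c d} (e : E a b) (f : E c d) → Stack e → a ≺ c → c ≺ b → b ≺ d → Queue f
    crossing-queue₂ e f se a≺c c≺b b≺d with stack-or-queue f
    ... | inj₁ sf = ⊥-elim (no-crossing e f se sf a≺c c≺b b≺d)
    ... | inj₂ qf = qf

    nesting-stack₁ : ∀ {a b c d} (e : E a b) (f : E c d) → Queue f → a ≺ c → c ≺ d → d ≺ b → Stack e
    nesting-stack₁ e f qf a≺c c≺d d≺b with stack-or-queue e
    ... | inj₁ se = se
    ... | inj₂ qe = ⊥-elim (no-nesting e f qe qf a≺c c≺d d≺b)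

    nesting-stack₂ : ∀ {a b c d} (e : E a b) (f : E c d) → Queue e → a ≺ c → c ≺ d → d ≺ b → Stack f
    nesting-stack₂ e f qe a≺c c≺d d≺b with stack-or-queue f
    ... | inj₁ sf = sf
    ... | inj₂ qf = ⊥-elim (no-nesting e f qe qf a≺c c≺d d≺b)

    ends-order : ∀ {n j p q} → Tree n j p q → p ≺ q ⊎ q ≺ p
    ends-order t = ≺-total (proj₂ (old₁ t)) (proj₂ (old₂ t)) (ends-distinct t)

    inside-stack : ∀ {a b c d n j} {e : E a b} → Queue e → (t : Tree n j c d) →
                   a ≺ c → c ≺ b → a ≺ d → d ≺ b → Stack (edge t)
    inside-stack {e = e} qe t a≺c c≺b a≺d d≺b with ends-order t
    ... | inj₁ c≺d = nesting-stack₂ e (edge t) qe a≺c c≺d d≺b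
    ... | inj₂ d≺c = stack-unsym (nesting-stack₂ e (E-sym (edge t)) qe a≺d d≺c c≺b)

    compare-kid : ∀ {n j p q z} (g : Node n j p q) i → Old j z → kid g i ≺ z ⊎ z ≺ kid g i
    compare-kid g i (z<N , z<M) =
      ≺-total (proj₂ (kid-old g i)) z<M λ y≡z → <-irrefl (sym y≡z) (<-≤-trans z<N (kid-fresh g i))

    Inside : ∀ {n j p q} → Node n j p q → Fin L → Set
    Inside {p = p} {q} g i = p ≺ kid g i × kid g i ≺ q

    module _ {n j p q} (g : Node n j p q) where
      private
        y = kid g

      Left Right Between : Fin L → Set
      Left i    = y i ≺ p × y i ≺ q
      Right i   = p ≺ y i × q ≺ y i
      Between i = (p ≺ y i × y i ≺ q) ⊎ (q ≺ y i × y i ≺ p)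

      region : ∀ i → Left i ⊎ Between i ⊎ Right i
      region i with compare-kid g i (old₁ (base g)) | compare-kid g i (old₂ (base g))
      ... | inj₁ y≺p | inj₁ y≺q = inj₁ (y≺p , y≺q)
      ... | inj₁ y≺p | inj₂ q≺y = inj₂ (inj₁ (inj₂ (q≺y , y≺p)))
      ... | inj₂ p≺y | inj₁ y≺q = inj₂ (inj₁ (inj₁ (p≺y , y≺q)))
      ... | inj₂ p≺y | inj₂ q≺y = inj₂ (inj₂ (p≺y , q≺y))

      module Kids = Ascending (λ i i′ → y i ≺ y i′) ≺-trans ≺-irrefl
        (λ i≢i′ → ≺-total (proj₂ (kid-old g _)) (proj₂ (kid-old g _)) λ y≡y′ → i≢i′ (kid-injective g _ _ y≡y′))

      two-left-stacks : ¬ Many (Left ∩ SS g) 2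
      two-left-stacks m with Kids.ascending₂ m | ends-order (base g)
      ... | i , i′ , (_ , s₁ , _) , ((y′≺p , _) , _ , s₂′) , y≺y′ | inj₁ p≺q =
        no-crossing (E-sym (edge₁ g i)) (E-sym (edge₂ g i′)) (stack-sym s₁) (stack-sym s₂′) y≺y′ y′≺p p≺q
      ... | i , i′ , (_ , _ , s₂) , ((_ , y′≺q) , s₁′ , _) , y≺y′ | inj₂ q≺p =
        no-crossing (E-sym (edge₂ g i)) (E-sym (edge₁ g i′)) (stack-sym s₂) (stack-sym s₁′) y≺y′ y′≺q q≺p

      two-right-stacks : ¬ Many (Right ∩ SS g) 2
      two-right-stacks m with Kids.ascending₂ m | ends-order (base g)
      ... | i , i′ , ((_ , q≺y) , s₁ , _) , (_ , _ , s₂′) , y≺y′ | inj₁ p≺q =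
        no-crossing (edge₁ g i) (edge₂ g i′) s₁ s₂′ p≺q q≺y y≺y′
      ... | i , i′ , ((p≺y , _) , _ , s₂) , (_ , s₁′ , _) , y≺y′ | inj₂ q≺p =
        no-crossing (edge₂ g i) (edge₁ g i′) s₂ s₁′ q≺p p≺y y≺y′

      two-between-stacks : ¬ Many (Between ∩ SS g) 2
      two-between-stacks m with Kids.ascending₂ m
      ... | i , i′ , (inj₁ (p≺y , _) , _ , s₂) , (inj₁ (_ , y′≺q) , s₁′ , _) , y≺y′ =
        no-crossing (edge₁ g i′) (E-sym (edge₂ g i)) s₁′ (stack-sym s₂) p≺y y≺y′ y′≺q
      ... | i , i′ , (inj₂ (q≺y , _) , s₁ , _) , (inj₂ (_ , y′≺p) , _ , s₂′) , y≺y′ =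
        no-crossing (edge₂ g i′) (E-sym (edge₁ g i)) s₂′ (stack-sym s₁) q≺y y≺y′ y′≺p
      ... | _ , _ , (inj₁ (p≺y , _) , _) , (inj₂ (_ , y′≺p) , _) , y≺y′ =
        ≺-irrefl (≺-trans p≺y (≺-trans y≺y′ y′≺p))
      ... | _ , _ , (inj₂ (q≺y , _) , _) , (inj₁ (_ , y′≺q) , _) , y≺y′ =
        ≺-irrefl (≺-trans q≺y (≺-trans y≺y′ y′≺q))

      two-left-queues : ¬ Many (Left ∩ QQ g) 2
      two-left-queues m with Kids.ascending₂ m | ends-order (base g)
      ... | i , i′ , (_ , _ , q₂) , ((y′≺p , _) , q₁′ , _) , y≺y′ | inj₁ p≺q =
        no-nesting (E-sym (edge₂ g i)) (E-sym (edge₁ g i′)) (queue-sym q₂) (queue-sym q₁′) y≺y′ y′≺p p≺q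
      ... | i , i′ , (_ , q₁ , _) , ((_ , y′≺q) , _ , q₂′) , y≺y′ | inj₂ q≺p =
        no-nesting (E-sym (edge₁ g i)) (E-sym (edge₂ g i′)) (queue-sym q₁) (queue-sym q₂′) y≺y′ y′≺q q≺p

      two-right-queues : ¬ Many (Right ∩ QQ g) 2
      two-right-queues m with Kids.ascending₂ m | ends-order (base g)
      ... | i , i′ , ((_ , q≺y) , _ , q₂) , (_ , q₁′ , _) , y≺y′ | inj₁ p≺q =
        no-nesting (edge₁ g i′) (edge₂ g i) q₁′ q₂ p≺q q≺y y≺y′
      ... | i , i′ , ((p≺y , _) , q₁ , _) , (_ , _ , q₂′) , y≺y′ | inj₂ q≺p =
        no-nesting (edge₂ g i′) (edge₁ g i) q₂′ q₁ q≺p p≺y y≺y′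

      Rare : Fin L → Set
      Rare = Left ∩ SS g ∪ Between ∩ SS g ∪ Right ∩ SS g ∪ Left ∩ QQ g ∪ Right ∩ QQ g

      at-most-five-rare : ¬ Many Rare 6
      at-most-five-rare =
        two-left-stacks ∣ two-between-stacks ∣ two-right-stacks ∣ two-left-queues ∣ two-right-queues

      stack-rare : ∀ {i} → SS g i → Rare i
      stack-rare {i} ss with region i
      ... | inj₁ l         = inj₁ (l , ss)
      ... | inj₂ (inj₁ b) = inj₂ (inj₁ (b , ss))
      ... | inj₂ (inj₂ r) = inj₂ (inj₂ (inj₁ (r , ss)))

      left-queue-rare : ∀ {i} → Left i → QQ g i → Rare i
      left-queue-rare l qq = inj₂ (inj₂ (inj₂ (inj₁ (l , qq))))

      right-queue-rare : ∀ {i} → Right i → QQ g i → Rare i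
      right-queue-rare r qq = inj₂ (inj₂ (inj₂ (inj₂ (r , qq))))

      not-all-rare : ¬ (∀ i → Rare i)
      not-all-rare = refute-all at-most-five-rare

  module LeftQS (O : Layout) where
    open Layout O
    open Basic O

    -- A kid x of the edge v u₂ left of u₁ has two queue edges (both cross the stack edge u₁w), so
    -- there is at most one.  A kid between u₁ and v is impossible, as all kids of u₂x would be rare,
    -- and one beyond v is impossible outright.
    no-left-QS-pair : ∀ {n j v w} (r : Node (2 + n) j v w) {i₁ i₂ i₃} → v ≺ w →
                   kid r i₁ ≺ kid r i₂ → kid r i₂ ≺ kid r i₃ → kid r i₃ ≺ v → QS r i₁ → QS r i₃ → ⊥
    no-left-QS-pair {n} {j} {v} {w} r {i₁} {i₂} {i₃} v≺w u₁≺u₂ u₂≺u₃ u₃≺v (q₁ , s₁) (q₃ , s₃) =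
      refute-all (two-left-queues h ∣ none no-kid-between-u₁-v) classify
      where
      u₁ = kid r i₁
      u₂ = kid r i₂
      u₂≺v = ≺-trans u₂≺u₃ u₃≺v
      u₁≺v = ≺-trans u₁≺u₂ u₂≺v
      u₂≺w = ≺-trans u₂≺v v≺w
      v-old = old₁ (base r)
      w-old = old₂ (base r)
      h = tree₁ r i₂

      beyond-v : ∀ {z} (e : E u₂ z) → v ≺ z → z ≺ w ⊎ w ≺ z → ⊥
      beyond-v e v≺z (inj₁ z≺w) =
        no-crossing e (E-sym (edge₂ r i₃)) (nesting-stack₁ e (E-sym (edge₁ r i₃)) (queue-sym q₃) u₂≺u₃ u₃≺v v≺z)
          (stack-sym s₃) u₂≺u₃ (≺-trans u₃≺v v≺z) z≺w
      beyond-v e v≺z (inj₂ w≺z) =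
        no-crossing (E-sym (edge₂ r i₁)) e (stack-sym s₁)
          (nesting-stack₁ e (E-sym (edge₁ r i₃)) (queue-sym q₃) u₂≺u₃ u₃≺v (≺-trans v≺w w≺z)) u₁≺u₂ u₂≺w w≺z

      queue-left-of-u₁ : ∀ {a x} (e : E a x) → x ≺ u₁ → u₁ ≺ a → a ≺ w → Queue e
      queue-left-of-u₁ e x≺u₁ u₁≺a a≺w =
        queue-unsym (crossing-queue₁ (E-sym e) (E-sym (edge₂ r i₁)) (stack-sym s₁) x≺u₁ u₁≺a a≺w)

      no-kid-between-u₁-v : ∀ {k} → ¬ (u₁ ≺ kid h k × kid h k ≺ v)
      no-kid-between-u₁-v {k} (u₁≺x , x≺v) = not-all-rare g all-rare
        where
        g = tree₂ h k
        x≺w = ≺-trans x≺v v≺w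
        all-rare : ∀ t → Rare g t
        all-rare t with compare-kid g t (old-suc (kid-old r i₁))
        ... | inj₁ z≺u₁ = left-queue-rare g (≺-trans z≺u₁ u₁≺u₂ , ≺-trans z≺u₁ u₁≺x)
                            ( queue-left-of-u₁ (edge₁ g t) z≺u₁ u₁≺u₂ u₂≺w
                            , queue-left-of-u₁ (edge₂ g t) z≺u₁ u₁≺x x≺w)
        ... | inj₂ u₁≺z with compare-kid g t (old-suc (old-suc v-old))
        ...   | inj₁ z≺v = stack-rare g
                  ( inside-stack (queue-sym q₁) (tree₁ g t) u₁≺u₂ u₂≺v u₁≺z z≺v
                  , inside-stack (queue-sym q₁) (tree₂ g t) u₁≺x x≺v u₁≺z z≺v)
        ...   | inj₂ v≺z = ⊥-elim (beyond-v (edge₁ g t) v≺z (compare-kid g t (old-suc (old-suc w-old))))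

      classify : ∀ k → (Left h ∩ QQ h ∪ (λ k → u₁ ≺ kid h k × kid h k ≺ v)) k
      classify k with compare-kid h k (kid-old r i₁)
      ... | inj₁ x≺u₁ = inj₁ ( (≺-trans x≺u₁ u₁≺v , ≺-trans x≺u₁ u₁≺u₂)
                             , queue-left-of-u₁ (edge₁ h k) x≺u₁ u₁≺v v≺w
                             , queue-left-of-u₁ (edge₂ h k) x≺u₁ u₁≺u₂ u₂≺w)
      ... | inj₂ u₁≺x with compare-kid h k (old-suc v-old)
      ...   | inj₁ x≺v = inj₂ (u₁≺x , x≺v)
      ...   | inj₂ v≺x = ⊥-elim (beyond-v (edge₂ h k) v≺x (compare-kid h k (old-suc w-old)))

    at-most-two-left-QS : ∀ {n j v w} (r : Node (2 + n) j v w) → v ≺ w → ¬ Many (Left r ∩ QS r) 3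
    at-most-two-left-QS r v≺w m =
      let i₁ , i₂ , i₃ , ((_ , qs₁) , _ , (u₃≺v , _) , qs₃) , u₁≺u₂ , u₂≺u₃ = Kids.ascending₃ r m
      in no-left-QS-pair r {i₁} {i₂} {i₃} v≺w u₁≺u₂ u₂≺u₃ u₃≺v qs₁ qs₃

  module LeftSQ (O : Layout) where
    open Layout O
    open Basic O
    open LeftQS O

    -- A kid x of v u₂ left of u₁ has a queue edge to u₂ (crossing the stack edge u₁v), so it is QS for
    -- the edge u₂v or rare; all other kids are rare.
    no-left-SQ-pair : ∀ {n j v w} (r : Node (3 + n) j v w) {i₁ i₂ i₃} → v ≺ w →
                   kid r i₁ ≺ kid r i₂ → kid r i₂ ≺ kid r i₃ → kid r i₃ ≺ v →
                   SQ r i₁ → Queue (edge₂ r i₃) → ⊥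
    no-left-SQ-pair {n} {j} {v} {w} r {i₁} {i₂} {i₃} v≺w u₁≺u₂ u₂≺u₃ u₃≺v (s₁ , q₁) q₃ =
      refute-all (at-most-two-left-QS (tree-sym h) u₂≺v ∣ at-most-five-rare h) classify
      where
      u₁ = kid r i₁
      u₂ = kid r i₂
      u₂≺v = ≺-trans u₂≺u₃ u₃≺v
      u₁≺v = ≺-trans u₁≺u₂ u₂≺v
      u₂≺w = ≺-trans u₂≺v v≺w
      h = tree₁ r i₂

      classify : ∀ k → (Left (tree-sym h) ∩ QS (tree-sym h) ∪ Rare h) k
      classify k with compare-kid h k (kid-old r i₁)
      ... | inj₁ x≺u₁ = by-colour (stack-or-queue (edge₁ h k))
        where
        left = ≺-trans x≺u₁ u₁≺u₂ , ≺-trans x≺u₁ u₁≺v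
        q : Queue (edge₂ h k)
        q = queue-unsym
              (crossing-queue₁ (E-sym (edge₂ h k)) (E-sym (edge₁ r i₁)) (stack-sym s₁) x≺u₁ u₁≺u₂ u₂≺v)
        by-colour : Stack (edge₁ h k) ⊎ Queue (edge₁ h k) → (Left (tree-sym h) ∩ QS (tree-sym h) ∪ Rare h) k
        by-colour (inj₁ s) = inj₁ (left , q , s)
        by-colour (inj₂ q′) = inj₂ (left-queue-rare h (Product.swap left) (q′ , q))
      ... | inj₂ u₁≺x with compare-kid h k (old-suc (old₂ (base r)))
      ...   | inj₁ x≺w = inj₂ (stack-rare h
                ( inside-stack (queue-sym q₁) (tree₁ h k) u₁≺v v≺w u₁≺x x≺w
                , inside-stack (queue-sym q₁) (tree₂ h k) u₁≺u₂ u₂≺w u₁≺x x≺w))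
      ...   | inj₂ w≺x = ⊥-elim (no-crossing (E-sym (edge₁ r i₁)) (edge₂ h k) (stack-sym s₁)
                (nesting-stack₁ (edge₂ h k) (E-sym (edge₂ r i₃)) (queue-sym q₃) u₂≺u₃ (≺-trans u₃≺v v≺w) w≺x)
                u₁≺u₂ u₂≺v (≺-trans v≺w w≺x))

    at-most-two-left-SQ : ∀ {n j v w} (r : Node (3 + n) j v w) → v ≺ w → ¬ Many (Left r ∩ SQ r) 3
    at-most-two-left-SQ r v≺w m =
      let i₁ , i₂ , i₃ , ((_ , sq₁) , _ , (u₃≺v , _) , _ , q₃) , u₁≺u₂ , u₂≺u₃ = Kids.ascending₃ r m
      in no-left-SQ-pair r {i₁} {i₂} {i₃} v≺w u₁≺u₂ u₂≺u₃ u₃≺v sq₁ q₃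

  module MiddleQS (O : Layout) where
    open Layout O
    open Basic O
    private
      module Mirror = Basic (mirror O)
      module MirrorQS = LeftQS (mirror O)

    -- Kids x of v u₂ lie right of u₁.  Between u₁ and u₃ they are impossible, as all kids of u₂x would
    -- be rare; right of u₃ they have a queue edge to u₂, hence are QS for u₂v or right queue pairs.
    no-middle-QS-pair : ∀ {n j v w} (r : Node (3 + n) j v w) {i₁ i₂ i₃} →
                     v ≺ kid r i₁ → kid r i₁ ≺ kid r i₂ → kid r i₂ ≺ kid r i₃ → kid r i₃ ≺ w →
                     QS r i₁ → QS r i₃ → ⊥
    no-middle-QS-pair {n} {j} {v} {w} r {i₁} {i₂} {i₃} v≺u₁ u₁≺u₂ u₂≺u₃ u₃≺w (q₁ , s₁) (q₃ , s₃) =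
      refute-all (MirrorQS.at-most-two-left-QS (tree-sym h) v≺u₂ ∣ two-right-queues h) classify
      where
      u₁ = kid r i₁
      u₂ = kid r i₂
      u₃ = kid r i₃
      v≺u₂ = ≺-trans v≺u₁ u₁≺u₂
      v≺u₃ = ≺-trans v≺u₂ u₂≺u₃
      u₂≺w = ≺-trans u₂≺u₃ u₃≺w
      v-old = old₁ (base r)
      w-old = old₂ (base r)
      h = tree₁ r i₂

      stack₁ : Stack (E-sym (edge₂ r i₁))
      stack₁ = stack-sym s₁
      stack₃ : Stack (E-sym (edge₂ r i₃))
      stack₃ = stack-sym s₃

      queue-right-of-u₃ : ∀ {a z} (e : E a z) → a ≺ u₃ → u₃ ≺ z → z ≺ w ⊎ w ≺ z → u₁ ≺ a → Queue e
      queue-right-of-u₃ e a≺u₃ u₃≺z (inj₁ z≺w) _   = crossing-queue₁ e (E-sym (edge₂ r i₃)) stack₃ a≺u₃ u₃≺z z≺w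
      queue-right-of-u₃ e a≺u₃ u₃≺z (inj₂ w≺z) u₁≺a =
        crossing-queue₂ (E-sym (edge₂ r i₁)) e stack₁ u₁≺a (≺-trans a≺u₃ u₃≺w) w≺z

      no-kid-between-u₁-u₃ : ∀ {k} → u₁ ≺ kid h k → kid h k ≺ u₃ → ⊥
      no-kid-between-u₁-u₃ {k} u₁≺x x≺u₃ = not-all-rare g all-rare
        where
        g = tree₂ h k
        v≺x = ≺-trans v≺u₁ u₁≺x
        all-rare : ∀ t → Rare g t
        all-rare t with compare-kid g t (old-suc (old-suc v-old))
        ... | inj₁ z≺v = ⊥-elim (no-crossing (E-sym (edge₂ g t)) (E-sym (edge₂ r i₁))
                (nesting-stack₁ (E-sym (edge₂ g t)) (edge₁ r i₁) q₁ z≺v v≺u₁ u₁≺x) stack₁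
                (≺-trans z≺v v≺u₁) u₁≺x (≺-trans x≺u₃ u₃≺w))
        ... | inj₂ v≺z with compare-kid g t (old-suc (kid-old r i₃))
        ...   | inj₁ z≺u₃ = stack-rare g
                  ( inside-stack q₃ (tree₁ g t) v≺u₂ u₂≺u₃ v≺z z≺u₃
                  , inside-stack q₃ (tree₂ g t) v≺x x≺u₃ v≺z z≺u₃)
        ...   | inj₂ u₃≺z = right-queue-rare g (≺-trans u₂≺u₃ u₃≺z , ≺-trans x≺u₃ u₃≺z)
                  ( queue-right-of-u₃ (edge₁ g t) u₂≺u₃ u₃≺z z-w u₁≺u₂
                  , queue-right-of-u₃ (edge₂ g t) x≺u₃ u₃≺z z-w u₁≺x)
          where z-w = compare-kid g t (old-suc (old-suc w-old))

      Class : Fin L → Set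
      Class = Mirror.Left (tree-sym h) ∩ QS (tree-sym h) ∪ Right h ∩ QQ h

      right-of-u₃ : ∀ k → u₃ ≺ kid h k → Queue (edge₂ h k) → Class k
      right-of-u₃ k u₃≺x q with stack-or-queue (edge₁ h k)
      ... | inj₁ s  = inj₁ ((≺-trans u₂≺u₃ u₃≺x , ≺-trans v≺u₃ u₃≺x) , q , s)
      ... | inj₂ q′ = inj₂ ((≺-trans v≺u₃ u₃≺x , ≺-trans u₂≺u₃ u₃≺x) , q′ , q)

      classify : ∀ k → Class k
      classify k with compare-kid h k (old-suc v-old)
      ... | inj₁ x≺v = ⊥-elim (no-nesting (E-sym (edge₂ h k)) (edge₁ r i₁)
              (crossing-queue₁ (E-sym (edge₂ h k)) (E-sym (edge₂ r i₁)) stack₁ (≺-trans x≺v v≺u₁) u₁≺u₂ u₂≺w)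
              q₁ x≺v v≺u₁ u₁≺u₂)
      ... | inj₂ v≺x with compare-kid h k (kid-old r i₁)
      ...   | inj₁ x≺u₁ = ⊥-elim (no-crossing (E-sym (edge₂ h k)) (E-sym (edge₂ r i₁))
                (nesting-stack₂ (edge₁ r i₃) (E-sym (edge₂ h k)) q₃ v≺x (≺-trans x≺u₁ u₁≺u₂) u₂≺u₃)
                stack₁ x≺u₁ u₁≺u₂ u₂≺w)
      ...   | inj₂ u₁≺x with compare-kid h k (kid-old r i₃)
      ...     | inj₁ x≺u₃ = ⊥-elim (no-kid-between-u₁-u₃ u₁≺x x≺u₃)
      ...     | inj₂ u₃≺x = right-of-u₃ k u₃≺x
                  (queue-right-of-u₃ (edge₂ h k) u₂≺u₃ u₃≺x (compare-kid h k (old-suc w-old)) u₁≺u₂)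

    at-most-two-middle-QS : ∀ {n j v w} (r : Node (3 + n) j v w) → ¬ Many (Inside r ∩ QS r) 3
    at-most-two-middle-QS r m =
      let i₁ , i₂ , i₃ , (((v≺u₁ , _) , qs₁) , _ , (_ , u₃≺w) , qs₃) , u₁≺u₂ , u₂≺u₃ = Kids.ascending₃ r m
      in no-middle-QS-pair r {i₁} {i₂} {i₃} v≺u₁ u₁≺u₂ u₂≺u₃ u₃≺w qs₁ qs₃

  module QueuePair (O : Layout) where
    open Layout O
    open Basic O
    open LeftQS O

    -- Each edge from p or q to a kid of z lies inside or around one of the four queue edges, so it is
    -- a stack and every kid of z is rare.
    no-node-between-queue-pair :
      ∀ {n m j v w p q} (r : Node n j v w) {i₁ i₅} →
      v ≺ kid r i₁ → kid r i₁ ≺ kid r i₅ → kid r i₅ ≺ w → QQ r i₁ → QQ r i₅ →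
      (z : Node m (2 + j) p q) → kid r i₁ ≺ p → p ≺ kid r i₅ → kid r i₁ ≺ q → q ≺ kid r i₅ → ⊥
    no-node-between-queue-pair {v = v} {w} r {i₁} {i₅} v≺u₁ u₁≺u₅ u₅≺w (qv₁ , qw₁) (qv₅ , qw₅)
      z u₁≺p p≺u₅ u₁≺q q≺u₅ = not-all-rare z λ t →
        stack-rare z (stack-to-kid t (tree₁ z t) u₁≺p p≺u₅ , stack-to-kid t (tree₂ z t) u₁≺q q≺u₅)
      where
      u₁ = kid r i₁
      u₅ = kid r i₅
      stack-to-kid : ∀ t {m′ j′ a} (tr : Tree m′ j′ a (kid z t)) → u₁ ≺ a → a ≺ u₅ → Stack (edge tr)
      stack-to-kid t tr u₁≺a a≺u₅ with compare-kid z t (old-suc (old-suc (old₁ (base r))))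
      ... | inj₁ y≺v = stack-unsym (nesting-stack₁ (E-sym (edge tr)) (edge₁ r i₁) qv₁ y≺v v≺u₁ u₁≺a)
      ... | inj₂ v≺y with compare-kid z t (old-suc (kid-old r i₅))
      ...   | inj₁ y≺u₅ = inside-stack qv₅ tr (≺-trans v≺u₁ u₁≺a) a≺u₅ v≺y y≺u₅
      ...   | inj₂ u₅≺y with compare-kid z t (old-suc (old-suc (old₂ (base r))))
      ...     | inj₁ y≺w = inside-stack (queue-sym qw₁) tr u₁≺a (≺-trans a≺u₅ u₅≺w) (≺-trans u₁≺u₅ u₅≺y) y≺w
      ...     | inj₂ w≺y = nesting-stack₁ (edge tr) (E-sym (edge₂ r i₅)) (queue-sym qw₅) a≺u₅ u₅≺w w≺y

    -- Edges from u₂ to vertices beyond u₅ would be stacks crossing c u₃.  So a kid of v u₂ lies either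
    -- left of v (at most two QS and one SS such kids) or between v and u₁ with a stack edge to u₂
    -- (at most two).
    no-queue-pair-around-stack :
      ∀ {n j v w c} (r : Node (3 + n) j v w) {i₁ i₂ i₃ i₅} →
      v ≺ kid r i₁ → kid r i₁ ≺ kid r i₂ → kid r i₂ ≺ kid r i₃ → kid r i₃ ≺ kid r i₅ → kid r i₅ ≺ w →
      QQ r i₁ → QQ r i₅ → (e : E c (kid r i₃)) → Stack e → c ≺ kid r i₁ → ⊥
    no-queue-pair-around-stack {n} {j} {v} {w} {c} r {i₁} {i₂} {i₃} {i₅} v≺u₁ u₁≺u₂ u₂≺u₃ u₃≺u₅ u₅≺w
      qq₁@(qv₁ , qw₁) qq₅@(qv₅ , qw₅) e s c≺u₁ =
      refute-all (at-most-two-left-QS h v≺u₂ ∣ two-left-stacks h ∣ three-low-stacks) classify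
      where
      u₁ = kid r i₁
      u₂ = kid r i₂
      u₃ = kid r i₃
      u₅ = kid r i₅
      v≺u₂ = ≺-trans v≺u₁ u₁≺u₂
      u₂≺u₅ = ≺-trans u₂≺u₃ u₃≺u₅
      u₁≺u₅ = ≺-trans u₁≺u₂ u₂≺u₅
      u₂≺w = ≺-trans u₂≺u₅ u₅≺w
      v-old = old₁ (base r)
      w-old = old₂ (base r)
      h = tree₁ r i₂

      beyond-u₅ : ∀ {m j′ y} (t : Tree m j′ u₂ y) → u₅ ≺ y → y ≺ w ⊎ w ≺ y → ⊥
      beyond-u₅ t u₅≺y y-w =
        no-crossing e (edge t) s (stack y-w) (≺-trans c≺u₁ u₁≺u₂) u₂≺u₃ (≺-trans u₃≺u₅ u₅≺y)
        where
        stack : _ → Stack (edge t)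
        stack (inj₁ y≺w) = inside-stack (queue-sym qw₁) t u₁≺u₂ u₂≺w (≺-trans u₁≺u₅ u₅≺y) y≺w
        stack (inj₂ w≺y) = nesting-stack₁ (edge t) (E-sym (edge₂ r i₅)) (queue-sym qw₅) u₂≺u₅ u₅≺w w≺y

      Low : Fin L → Set
      Low k = (v ≺ kid h k × kid h k ≺ u₁) × Stack (edge₂ h k)

      low-stacks : ∀ {m₁ m₂ m₃} → v ≺ kid h m₁ → kid h m₁ ≺ kid h m₂ → kid h m₂ ≺ kid h m₃ → kid h m₃ ≺ u₁ →
                   Stack (edge₂ h m₁) → Stack (edge₂ h m₂) → ⊥
      low-stacks {m₁} {m₂} {m₃} v≺m₁ m₁≺m₂ m₂≺m₃ m₃≺u₁ s₁ s₂ = not-all-rare g all-rare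
        where
        g = tree₂ h m₃
        m₂≺u₂ = ≺-trans m₂≺m₃ (≺-trans m₃≺u₁ u₁≺u₂)
        v≺m₂ = ≺-trans v≺m₁ m₁≺m₂
        q₂ : Queue (edge₁ h m₂)
        q₂ = crossing-queue₁ (edge₁ h m₂) (E-sym (edge₂ h m₁)) (stack-sym s₁) v≺m₁ m₁≺m₂ m₂≺u₂
        all-rare : ∀ t → Rare g t
        all-rare t with compare-kid g t (old-suc (old-suc v-old))
        ... | inj₁ y≺v = ⊥-elim (no-nesting (E-sym (edge₂ g t)) (edge₁ h m₂)
                (crossing-queue₁ (E-sym (edge₂ g t)) (E-sym (edge₂ h m₂)) (stack-sym s₂)
                  (≺-trans y≺v v≺m₂) m₂≺m₃ (≺-trans m₃≺u₁ u₁≺u₂))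
                q₂ y≺v v≺m₂ m₂≺m₃)
        ... | inj₂ v≺y with compare-kid g t (old-suc (kid-old r i₅))
        ...   | inj₁ y≺u₅ = stack-rare g
                  ( inside-stack qv₅ (tree₁ g t) v≺u₂ u₂≺u₅ v≺y y≺u₅
                  , inside-stack qv₅ (tree₂ g t) (≺-trans v≺m₂ m₂≺m₃) (≺-trans m₃≺u₁ u₁≺u₅) v≺y y≺u₅)
        ...   | inj₂ u₅≺y = ⊥-elim (beyond-u₅ (tree₁ g t) u₅≺y (compare-kid g t (old-suc (old-suc w-old))))

      three-low-stacks : ¬ Many Low 3
      three-low-stacks m =
        let k₁ , k₂ , k₃ , (((v≺m₁ , _) , s₁) , (_ , s₂) , ((_ , m₃≺u₁) , _)) , m₁≺m₂ , m₂≺m₃ =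
              Kids.ascending₃ h m
        in low-stacks {k₁} {k₂} {k₃} v≺m₁ m₁≺m₂ m₂≺m₃ m₃≺u₁ s₁ s₂

      classify : ∀ k → (Left h ∩ QS h ∪ Left h ∩ SS h ∪ Low) k
      classify k with compare-kid h k (old-suc v-old)
      ... | inj₁ x≺v with stack-or-queue (edge₁ h k)
      ...   | inj₁ s₁ = inj₂ (inj₁ ((x≺v , ≺-trans x≺v v≺u₂) , s₁ , s₂))
        where s₂ = stack-unsym (nesting-stack₁ (E-sym (edge₂ h k)) (edge₁ r i₁) qv₁ x≺v v≺u₁ u₁≺u₂)
      ...   | inj₂ q₁ = inj₁ ((x≺v , ≺-trans x≺v v≺u₂) , q₁ , s₂)
        where s₂ = stack-unsym (nesting-stack₁ (E-sym (edge₂ h k)) (edge₁ r i₁) qv₁ x≺v v≺u₁ u₁≺u₂)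
      classify k | inj₂ v≺x with compare-kid h k (kid-old r i₁)
      ...   | inj₁ x≺u₁ = inj₂ (inj₂ ((v≺x , x≺u₁) ,
                inside-stack qv₅ (tree₂ h k) v≺u₂ u₂≺u₅ v≺x (≺-trans x≺u₁ u₁≺u₅)))
      ...   | inj₂ u₁≺x with compare-kid h k (kid-old r i₅)
      ...     | inj₁ x≺u₅ = ⊥-elim (no-node-between-queue-pair r v≺u₁ u₁≺u₅ u₅≺w qq₁ qq₅ (tree₂ h k)
                                      u₁≺u₂ u₂≺u₅ u₁≺x x≺u₅)
      ...     | inj₂ u₅≺x = ⊥-elim (beyond-u₅ (tree₂ h k) u₅≺x (compare-kid h k (old-suc w-old)))

  some-kid : Fin L
  some-kid = fromℕ< (<-≤-trans (s≤s z≤n) 33≤L)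

  module MiddleQQ (O : Layout) where
    open Layout O
    open Basic O
    open QueuePair O
    private
      module Mirror = QueuePair (mirror O)

    -- Take any kid c of v u₃.  If c lies between u₁ and u₅, the tree above u₃c is a node between the
    -- queue pair; otherwise c u₃ is a stack edge that the pair cannot surround.
    no-middle-QQ-pair :
      ∀ {n j v w} (r : Node (3 + n) j v w) {i₁ i₂ i₃ i₄ i₅} →
      v ≺ kid r i₁ → kid r i₁ ≺ kid r i₂ → kid r i₂ ≺ kid r i₃ → kid r i₃ ≺ kid r i₄ →
      kid r i₄ ≺ kid r i₅ → kid r i₅ ≺ w → QQ r i₁ → QQ r i₅ → ⊥
    no-middle-QQ-pair {n} {j} {v} {w} r {i₁} {i₂} {i₃} {i₄} {i₅} v≺u₁ u₁≺u₂ u₂≺u₃ u₃≺u₄ u₄≺u₅ u₅≺w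
      qq₁@(qv₁ , qw₁) qq₅@(qv₅ , qw₅) =
      by-position-of-c (compare-kid h₃ some-kid (kid-old r i₁)) (compare-kid h₃ some-kid (kid-old r i₅))
      where
      u₁ = kid r i₁
      u₅ = kid r i₅
      u₁≺u₃ = ≺-trans u₁≺u₂ u₂≺u₃
      u₃≺u₅ = ≺-trans u₃≺u₄ u₄≺u₅
      u₁≺u₅ = ≺-trans u₁≺u₃ u₃≺u₅
      v≺u₃ = ≺-trans v≺u₁ u₁≺u₃
      u₃≺w = ≺-trans u₃≺u₅ u₅≺w
      h₃ = tree₁ r i₃
      c = kid h₃ some-kid
      t₃ = tree-sym (tree₂ h₃ some-kid)

      stack-left : c ≺ u₁ → c ≺ v ⊎ v ≺ c → Stack (edge t₃)
      stack-left _     (inj₁ c≺v) = nesting-stack₁ (edge t₃) (edge₁ r i₁) qv₁ c≺v v≺u₁ u₁≺u₃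
      stack-left c≺u₁ (inj₂ v≺c) = inside-stack qv₅ t₃ v≺c (≺-trans c≺u₁ u₁≺u₅) v≺u₃ u₃≺u₅

      stack-right : u₅ ≺ c → c ≺ w ⊎ w ≺ c → Stack (edge t₃)
      stack-right u₅≺c (inj₁ c≺w) = inside-stack (queue-sym qw₁) t₃ (≺-trans u₁≺u₅ u₅≺c) c≺w u₁≺u₃ u₃≺w
      stack-right _     (inj₂ w≺c) =
        stack-sym (nesting-stack₁ (edge₂ h₃ some-kid) (E-sym (edge₂ r i₅)) (queue-sym qw₅) u₃≺u₅ u₅≺w w≺c)

      by-position-of-c : c ≺ u₁ ⊎ u₁ ≺ c → c ≺ u₅ ⊎ u₅ ≺ c → ⊥
      by-position-of-c (inj₁ c≺u₁) _ =
        no-queue-pair-around-stack r {i₁} {i₂} {i₃} {i₅} v≺u₁ u₁≺u₂ u₂≺u₃ u₃≺u₅ u₅≺w qq₁ qq₅ (edge t₃)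
          (stack-left c≺u₁ (compare-kid h₃ some-kid (old-suc (old₁ (base r))))) c≺u₁
      by-position-of-c (inj₂ u₁≺c) (inj₁ c≺u₅) =
        no-node-between-queue-pair r v≺u₁ u₁≺u₅ u₅≺w qq₁ qq₅ (tree₂ h₃ some-kid) u₁≺u₃ u₃≺u₅ u₁≺c c≺u₅
      by-position-of-c (inj₂ _) (inj₂ u₅≺c) =
        Mirror.no-queue-pair-around-stack (tree-sym r) {i₅} {i₄} {i₃} {i₁} u₅≺w u₄≺u₅ u₃≺u₄ u₁≺u₃ v≺u₁
          (Product.swap qq₅) (Product.swap qq₁) (edge t₃)
          (stack-right u₅≺c (compare-kid h₃ some-kid (old-suc (old₂ (base r))))) u₅≺c

    at-most-four-middle-QQ : ∀ {n j v w} (r : Node (3 + n) j v w) → ¬ Many (Inside r ∩ QQ r) 5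
    at-most-four-middle-QQ r m =
      let i₁ , i₂ , i₃ , i₄ , i₅ , ((((v≺u₁ , _) , qq₁) , ((_ , u₅≺w) , qq₅)) , u₁≺u₂ , u₂≺u₃ , u₃≺u₄ , u₄≺u₅) =
            Kids.ascending₅ r m
      in no-middle-QQ-pair r {i₁} {i₂} {i₃} {i₄} {i₅} v≺u₁ u₁≺u₂ u₂≺u₃ u₃≺u₄ u₄≺u₅ u₅≺w qq₁ qq₅

  module Root (O : Layout) where
    open Layout O
    open Basic O
    open LeftQS O
    open LeftSQ O
    open MiddleQS O
    open MiddleQQ O
    private
      module Mirror = Basic (mirror O)
      module MirrorQS = LeftQS (mirror O)
      module MirrorSQ = LeftSQ (mirror O)
      module MirrorMiddleQS = MiddleQS (mirror O)

    -- The capacities of the eight classes are 2, 2, 2, 2, 2, 2, 4 and 5: at most 21 kids fit.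
    no-deep-node : ∀ {n j v w} (r : Node (3 + n) j v w) → v ≺ w → ⊥
    no-deep-node {n} {j} {v} {w} r v≺w = refute-all
      ( at-most-two-left-SQ r v≺w ∣ at-most-two-left-QS r v≺w
      ∣ MirrorSQ.at-most-two-left-SQ r′ v≺w ∣ MirrorQS.at-most-two-left-QS r′ v≺w
      ∣ at-most-two-middle-QS r ∣ MirrorMiddleQS.at-most-two-middle-QS r′
      ∣ at-most-four-middle-QQ r ∣ at-most-five-rare r)
      classify
      where
      r′ = tree-sym r
      Class : Fin L → Set
      Class = Left r ∩ SQ r ∪ Left r ∩ QS r ∪ Mirror.Left r′ ∩ SQ r′ ∪ Mirror.Left r′ ∩ QS r′
            ∪ Inside r ∩ QS r ∪ Mirror.Inside r′ ∩ QS r′ ∪ Inside r ∩ QQ r ∪ Rare r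

      rare : ∀ {i} → Rare r i → Class i
      rare x = inj₂ (inj₂ (inj₂ (inj₂ (inj₂ (inj₂ (inj₂ x))))))

      classify : ∀ i → Class i
      classify i with region r i | colours r i
      ... | inj₁ l | inj₁ ss                    = rare (stack-rare r ss)
      ... | inj₁ l | inj₂ (inj₁ qq)             = rare (left-queue-rare r l qq)
      ... | inj₁ l | inj₂ (inj₂ (inj₁ qs))      = inj₂ (inj₁ (l , qs))
      ... | inj₁ l | inj₂ (inj₂ (inj₂ sq))      = inj₁ (l , sq)
      ... | inj₂ (inj₂ rt) | inj₁ ss               = rare (stack-rare r ss)
      ... | inj₂ (inj₂ rt) | inj₂ (inj₁ qq)        = rare (right-queue-rare r rt qq)
      ... | inj₂ (inj₂ rt) | inj₂ (inj₂ (inj₁ qs)) = inj₂ (inj₂ (inj₁ (Product.swap rt , Product.swap qs)))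
      ... | inj₂ (inj₂ rt) | inj₂ (inj₂ (inj₂ sq)) =
        inj₂ (inj₂ (inj₂ (inj₁ (Product.swap rt , Product.swap sq))))
      ... | inj₂ (inj₁ (inj₂ (w≺y , y≺v))) | _ = ⊥-elim (≺-irrefl (≺-trans v≺w (≺-trans w≺y y≺v)))
      ... | inj₂ (inj₁ (inj₁ m)) | inj₁ ss               = rare (stack-rare r ss)
      ... | inj₂ (inj₁ (inj₁ m)) | inj₂ (inj₁ qq)        =
        inj₂ (inj₂ (inj₂ (inj₂ (inj₂ (inj₂ (inj₁ (m , qq)))))))
      ... | inj₂ (inj₁ (inj₁ m)) | inj₂ (inj₂ (inj₁ qs)) = inj₂ (inj₂ (inj₂ (inj₂ (inj₁ (m , qs)))))
      ... | inj₂ (inj₁ (inj₁ m)) | inj₂ (inj₂ (inj₂ sq)) =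
        inj₂ (inj₂ (inj₂ (inj₂ (inj₂ (inj₁ (Product.swap m , Product.swap sq))))))

Attached : List (ℕ × ℕ) → ℕ → ℕ → ℕ → Set
Attached es x v w = (x , v) ∈ es × (x , w) ∈ es

∈-attachEdge : ∀ L c v w {i} → i < L → Attached (attachEdge L c v w) (c + i) v w
∈-attachEdge (suc L) c v w {zero} _ rewrite +-identityʳ c = here refl , there (here refl)
∈-attachEdge (suc L) c v w {suc i} (s≤s i<L) rewrite +-suc c i =
  Product.map (there ∘ there) (there ∘ there) (∈-attachEdge L (suc c) v w i<L)

∈-attachAll : ∀ L c es {v w} (vw∈es : (v , w) ∈ es) {i} → i < L →
              Attached (attachAll L c es) (c + L * toℕ (index vw∈es) + i) v w
∈-attachAll L c ((v , w) ∷ es) (here refl) {i} i<L rewrite *-zeroʳ L | +-identityʳ c =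
  Product.map ∈-++⁺ˡ ∈-++⁺ˡ (∈-attachEdge L c v w i<L)
∈-attachAll L c ((v′ , w′) ∷ es) (there vw∈es) {i} i<L
  rewrite *-suc L (toℕ (index vw∈es)) | sym (+-assoc c L (L * toℕ (index vw∈es))) =
  Product.map (∈-++⁺ʳ _) (∈-++⁺ʳ _) (∈-attachAll L (c + L) es vw∈es i<L)

attachEdge-∈⁻ : ∀ L c v w {x y} → (x , y) ∈ attachEdge L c v w → c ≤ x × x < c + L × (y ≡ v ⊎ y ≡ w)
attachEdge-∈⁻ (suc L) c v w (here refl)         = ≤-refl , m<m+n c z<s , inj₁ refl
attachEdge-∈⁻ (suc L) c v w (there (here refl)) = ≤-refl , m<m+n c z<s , inj₂ refl
attachEdge-∈⁻ (suc L) c v w (there (there xy∈)) with attachEdge-∈⁻ L (suc c) v w xy∈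
... | c<x , x<c+L , y≡ rewrite +-suc c L = <⇒≤ c<x , x<c+L , y≡

attachAll-∈⁻ : ∀ L c es {B x y} → All (λ (v , w) → v < B × w < B) es → (x , y) ∈ attachAll L c es →
               c ≤ x × x < c + L * length es × y < B
attachAll-∈⁻ L c ((v , w) ∷ es) {x = x} ((v<B , w<B) ∷ bounded) xy∈ with ∈-++⁻ (attachEdge L c v w) xy∈
... | inj₁ xy∈′ with attachEdge-∈⁻ L c v w xy∈′
...   | c≤x , x<c+L , inj₁ refl = c≤x , <-≤-trans x<c+L (+-monoʳ-≤ c (m≤m*n L (suc (length es)))) , v<B
...   | c≤x , x<c+L , inj₂ refl = c≤x , <-≤-trans x<c+L (+-monoʳ-≤ c (m≤m*n L (suc (length es)))) , w<B
attachAll-∈⁻ L c ((v , w) ∷ es) {x = x} (_ ∷ bounded) xy∈ | inj₂ xy∈′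
  with attachAll-∈⁻ L (c + L) es bounded xy∈′
... | c+L≤x , x<c+L+L*n , y<B rewrite +-assoc c L (L * length es) | sym (*-suc L (length es)) =
  ≤-trans (m≤m+n c L) c+L≤x , x<c+L+L*n , y<B

module Growth (ℓ : ℕ) where

  N : ℕ → ℕ
  N j = nV (G j ℓ)

  es : ℕ → List (ℕ × ℕ)
  es j = edges (G j ℓ)

  N-suc : ∀ j → N j ≤ N (suc j)
  N-suc zero    = ≤-refl
  N-suc (suc j) = m≤m+n _ _

  es-suc : ∀ j {e} → e ∈ es j → e ∈ es (suc j)
  es-suc zero    = id
  es-suc (suc j) = ∈-++⁺ˡ

  upward : (P : ℕ → Set) → (∀ {j} → P j → P (suc j)) → ∀ {j k} → j ≤ k → P j → P k
  upward P step j≤k = go (≤⇒≤′ j≤k)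
    where
    go : ∀ {j k} → j ≤′ k → P j → P k
    go ≤′-refl          = id
    go (≤′-step j≤′k) = step ∘ go j≤′k

  Proper : ℕ → ℕ × ℕ → Set
  Proper j (a , b) = a < N j × b < N j × a ≢ b

  es-proper : ∀ j → All (Proper (suc j)) (es (suc j))
  es-proper zero    = (z<s , s<s z<s , λ ()) ∷ []
  es-proper (suc j) = ++⁺ (All.map (λ (a<N , b<N , a≢b) → lift a<N , lift b<N , a≢b) (es-proper j))
                          (All.tabulate new-proper)
    where
    lift : ∀ {a} → a < N (suc j) → a < N (suc (suc j))
    lift a< = <-≤-trans a< (N-suc (suc j))
    new-proper : ∀ {e} → e ∈ attachAll ℓ (N (suc j)) (es (suc j)) → Proper (suc (suc j)) e
    new-proper e∈ with attachAll-∈⁻ ℓ (N (suc j)) (es (suc j))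
                         (All.map (λ (a<N , b<N , _) → a<N , b<N) (es-proper j)) e∈
    ... | N≤x , x<N′ , y<N = x<N′ , lift y<N , λ x≡y → <-irrefl (sym x≡y) (<-≤-trans y<N N≤x)

module FromMixedLayout {k ℓ : ℕ} (33≤ℓ : 33 ≤ ℓ) (layout : MixedLayout (G k ℓ)) where

  open Growth ℓ

  pos : ℕ → ℕ
  pos = proj₁ (proj₁ layout)

  colour : Fin (length (es k)) → Bool
  colour = proj₁ (proj₂ layout)

  data Link (j a b : ℕ) : Set where
    forward  : (a , b) ∈ es j → Link j a b
    backward : (b , a) ∈ es j → Link j a b

  link-sym : ∀ {j a b} → Link j a b → Link j b a
  link-sym (forward ab∈)  = backward ab∈
  link-sym (backward ba∈) = forward ba∈

  position : ∀ {j a b} → Link j a b → Fin (length (es j))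
  position (forward ab∈)  = index ab∈
  position (backward ba∈) = index ba∈

  side : ∀ {a b} → Link k a b → Bool
  side l = colour (position l)

  side-sym : ∀ {a b} (l : Link k a b) → side (link-sym l) ≡ side l
  side-sym (forward _)  = refl
  side-sym (backward _) = refl

  open Setting ℓ 33≤ℓ (N k) N N-suc (Link k) link-sym side side-sym

  oriented : ∀ {a b} (l : Link k a b) → pos a < pos b → Oriented pos (lookup (es k) (position l)) a b
  oriented (forward ab∈) a<b = inj₁ (cong proj₁ (lookup-index ab∈) , cong proj₂ (lookup-index ab∈)) , a<b
  oriented (backward ba∈) a<b = inj₂ (cong proj₂ (lookup-index ba∈) , cong proj₁ (lookup-index ba∈)) , a<b

  order : Layout
  order = record
    { _≺_         = λ a b → pos a < pos b
    ; ≺-trans     = <-trans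
    ; ≺-irrefl    = <-irrefl refl
    ; ≺-total     = total
    ; no-crossing = λ e f se sf a≺c c≺b b≺d → proj₁ (proj₂ (proj₂ layout)) (position e) (position f) se sf
        (_ , _ , _ , _ , oriented e (<-trans a≺c c≺b) , oriented f (<-trans c≺b b≺d) , a≺c , c≺b , b≺d)
    ; no-nesting  = λ e f qe qf a≺c c≺d d≺b → proj₂ (proj₂ (proj₂ layout)) (position e) (position f) qe qf
        (_ , _ , _ , _ , oriented e (<-trans a≺c (<-trans c≺d d≺b)) , oriented f c≺d , a≺c , c≺d , d≺b)
    }
    where
    total : ∀ {a b} → a < N k → b < N k → a ≢ b → pos a < pos b ⊎ pos b < pos a
    total {a} {b} a<M b<M a≢b with <-cmp (pos a) (pos b)
    ... | tri< a≺b _ _ = inj₁ a≺b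
    ... | tri≈ _ a≈b _ = ⊥-elim (a≢b (proj₂ (proj₁ layout) a b a<M b<M a≈b))
    ... | tri> _ _ b≺a = inj₂ b≺a

  module _ {j} (j<k : suc j ≤ k) where

    old : ∀ {a} → a < N (suc j) → Old (suc j) a
    old {a} a<N = a<N , upward (λ j → a < N j) (λ {j} a< → <-≤-trans a< (N-suc j)) j<k a<N

    present : ∀ {e} → e ∈ es (suc j) → e ∈ es k
    present {e} = upward (λ j → e ∈ es j) (λ {j} → es-suc j) j<k

    link-edge : ∀ {a b} → Link (suc j) a b → Edge (suc j) a b
    link-edge (forward ab∈) with All.lookup (es-proper j) ab∈
    ... | a<N , b<N , a≢b = forward (present ab∈) , old a<N , old b<N , a≢b
    link-edge (backward ba∈) with All.lookup (es-proper j) ba∈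
    ... | b<N , a<N , b≢a = backward (present ba∈) , old a<N , old b<N , λ a≡b → b≢a (sym a≡b)

  -- The label that attachAll gives to the i-th vertex attached to the edge with index position l.
  new-vertex : ∀ {j a b} → Link (suc j) a b → Fin ℓ → ℕ
  new-vertex {j} l i = N (suc j) + ℓ * toℕ (position l) + toℕ i

  attached-link : ∀ {j x c} → (x , c) ∈ attachAll ℓ (N (suc j)) (es (suc j)) → Link (suc (suc j)) c x
  attached-link {j} = backward ∘ ∈-++⁺ʳ (es (suc j))

  new-links : ∀ {j a b} (l : Link (suc j) a b) i →
              Link (suc (suc j)) a (new-vertex l i) × Link (suc (suc j)) b (new-vertex l i)
  new-links {j} (forward ab∈) i =
    Product.map attached-link attached-link (∈-attachAll ℓ (N (suc j)) (es (suc j)) ab∈ (toℕ<n i))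
  new-links {j} (backward ba∈) i =
    Product.swap (Product.map attached-link attached-link (∈-attachAll ℓ (N (suc j)) (es (suc j)) ba∈ (toℕ<n i)))

  build : ∀ n j {a b} → suc j + n ≤ k → Link (suc j) a b → Tree n (suc j) a b
  build zero    j fits l = link-edge (≤-trans (m≤m+n (suc j) 0) fits) l
  build (suc n) j fits l = record
    { base          = link-edge (≤-trans (m≤m+n (suc j) (suc n)) fits) l
    ; kid           = new-vertex l
    ; kid-fresh     = λ i → ≤-trans (m≤m+n _ _) (m≤m+n _ _)
    ; kid-injective = λ i i′ eq → toℕ-injective (+-cancelˡ-≡ _ _ _ eq)
    ; tree₁         = λ i → build n (suc j) fits′ (proj₁ (new-links l i))
    ; tree₂         = λ i → build n (suc j) fits′ (proj₂ (new-links l i))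
    }
    where
    fits′ : suc (suc j) + n ≤ k
    fits′ = subst (_≤ k) (+-suc (suc j) n) fits

  impossible : 5 ≤ k → ⊥
  impossible 5≤k = Sum.[ no-deep-node r , no-deep-node (tree-sym r) ] (ends-order r)
    where
    open Basic order
    open Root order
    r : Tree 4 1 0 1
    r = build 4 0 5≤k (forward (here refl))

theorem1 : ∀ k ℓ → 5 ≤ k → 33 ≤ ℓ → ¬ MixedLayout (G k ℓ)
theorem1 k ℓ 5≤k 33≤ℓ layout = FromMixedLayout.impossible 33≤ℓ layout 5≤k
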